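{- Among all near double brooms on $n$ vertices with diameter $d$ having $\ell=r$, the balanced near double broom $D'_{n,d}$ (singleton leaf adjacent to $v_{\lfloor d/2\rfloor}$) is the unique (up to isomorphism) minimizer of $\max_v J(v)$.
   Context: For a connected graph $G=(V,E)$ and simple random walk on $G$ (each step moves to a uniformly random neighbor), $H(u,v)$ is the expected number of steps for the walk from $u$ to reach $v$, with $H(u,u)=0$; the joining time is $J(v)=\sum_{u\in V}\deg(u)H(u,v)$. A double broom of diameter $d$ is a tree consisting of a path $v_1,\ldots,v_{d-1}$ with $\ell\ge1$ leaves adjacent to $v_1$ and $r\ge1$ leaves adjacent to $v_{d-1}$. A near double broom is a tree that is not a double broom but has a leaf $z$ (the singleton leaf) whose removal yields a double broom; as a tree of diameter $d\ge4$ it consists of a path $v_1,\ldots,v_{d-1}$, $\ell$ leaves adjacent to $v_1$, $r$ leaves adjacent to $v_{d-1}$, and the singleton leaf $z$ adjacent to some $v_k$ with $2\le k\le d-2$. The balanced near double broom $D'_{n,d}$ has $\ell=\lfloor (n-d)/2\rfloor$, $r=\lceil (n-d)/2\rceil$ and $z$ adjacent to $v_{\lfloor d/2\rfloor}$. -}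

module Defs where

open import Data.Nat using (ℕ; zero; suc; _+_; _*_; _∸_; _⊔_; _≡ᵇ_; _<ᵇ_)
open import Data.Bool using (Bool; true; false; not; _∧_; _∨_; if_then_else_)
open import Data.Fin using (Fin; toℕ)
open import Data.List using (List; foldr; map; allFin)
open import Data.Product using (Σ; _×_)
open import Relation.Binary.PropositionalEquality using (_≡_; _≢_)
open import Function.Bundles using (_↔_; Inverse)

record Graph (n : ℕ) : Set where
  field
    adj : Fin n → Fin n → Bool

open Graph public

sumFin : {n : ℕ} → (Fin n → ℕ) → ℕ
sumFin {n} f = foldr _+_ 0 (map f (allFin n))

maxFin : {n : ℕ} → (Fin n → ℕ) → ℕ
maxFin {n} f = foldr _⊔_ 0 (map f (allFin n))

nbrSum : {n : ℕ} → Graph n → Fin n → (Fin n → ℕ) → ℕ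
nbrSum G u f = sumFin (λ w → if adj G u w then f w else 0)

deg : {n : ℕ} → Graph n → Fin n → ℕ
deg G u = nbrSum G u (λ _ → 1)

-- H is the hitting-time table of simple random walk on G:
-- H u v is the expected number of steps from u to reach v.  It is
-- characterised (for connected G, uniquely) by the first-step equations
--   H v v = 0,
--   H u v = 1 + (1/deg u) Σ_{w ~ u} H w v   (u ≠ v),
-- written here with denominators cleared.
IsHittingTime : {n : ℕ} → Graph n → (Fin n → Fin n → ℕ) → Set
IsHittingTime {n} G H =
  ((v : Fin n) → H v v ≡ 0) ×
  ((u v : Fin n) → u ≢ v →
     deg G u * H u v ≡ deg G u + nbrSum G u (λ w → H w v))

joining : {n : ℕ} → Graph n → (Fin n → Fin n → ℕ) → Fin n → ℕ
joining G H v = sumFin (λ u → deg G u * H u v)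

maxJoining : {n : ℕ} → Graph n → (Fin n → Fin n → ℕ) → ℕ
maxJoining G H = maxFin (joining G H)

_≅_ : {n : ℕ} → Graph n → Graph n → Set
_≅_ {n} G G' = Σ (Fin n ↔ Fin n) λ σ →
  (a b : Fin n) → adj G a b ≡ adj G' (Inverse.to σ a) (Inverse.to σ b)

-- Near double broom with diameter d, ℓ = r leaves at both ends, and the
-- singleton leaf z adjacent to v_k.  Vertex set Fin (d + 2ℓ), numbered:
--   i       (0 ≤ i ≤ d-2)        : path vertex v_{i+1}
--   d-1 .. d-2+ℓ                 : the ℓ leaves adjacent to v_1
--   d-1+ℓ .. d-2+2ℓ              : the r = ℓ leaves adjacent to v_{d-1}
--   d-1+2ℓ                       : the singleton leaf z, adjacent to v_k

inRange : ℕ → ℕ → ℕ → Bool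
inRange x a b = not (x <ᵇ a) ∧ (x <ᵇ b)

-- directed "base" edges a → b; adjacency is their symmetric closure
nbBase : (d ℓ k : ℕ) → ℕ → ℕ → Bool
nbBase d ℓ k a b =
     ((b ≡ᵇ suc a) ∧ (b <ᵇ (d ∸ 1)))                              -- path v_{a+1} v_{a+2}
  ∨ (inRange a (d ∸ 1) ((d ∸ 1) + ℓ) ∧ (b ≡ᵇ 0))                     -- left leaves – v_1
  ∨ (inRange a ((d ∸ 1) + ℓ) ((d ∸ 1) + ℓ + ℓ) ∧ (b ≡ᵇ (d ∸ 2)))    -- right leaves – v_{d-1}
  ∨ ((a ≡ᵇ ((d ∸ 1) + ℓ + ℓ)) ∧ (b ≡ᵇ (k ∸ 1)))                  -- z – v_k

nearDoubleBroom : (d ℓ k : ℕ) → Graph (d + (ℓ + ℓ))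
nearDoubleBroom d ℓ k = record
  { adj = λ a b → nbBase d ℓ k (toℕ a) (toℕ b) ∨ nbBase d ℓ k (toℕ b) (toℕ a) }

{-# OPTIONS --safe #-}
module Submission where

-- The near double broom is a caterpillar: a spine v_1 … v_{d-1} carrying pendant leaves. Every
-- leaf that is not the target satisfies H(leaf, v) = 1 + H(anchor, v), and eliminating the leaves
-- turns the first-step equations for H(·, v) into those of a walk on the spine with vertex weights
-- (the total degree of a spine vertex and its leaves). On such a path the time to cross an edge
-- towards v is the total weight on its far side, and summation by parts gives J at a spine vertex
-- as the number of leaves plus the sum of the squared crossing times. Kac's formula gives
-- H(anchor, leaf) = 2|E| − 1, so J at a leaf exceeds J at its anchor by (2|E| − 1)² − 1. The spine
-- sum is valley-shaped along the spine, hence max J is attained at the two end bunches of leaves,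
-- and equals a constant plus max(E(d − 2 − q), E(q)) where E(q) is the spine sum towards v_{d-1}
-- when z hangs from v_{q+1}. E is strictly decreasing, so this maximum is least exactly when q or
-- d − 2 − q is ⌊(d − 2)/2⌋, and these two positions of z give mirror-image, isomorphic trees.

open import Defs
open import Data.Nat using (ℕ; _+_; _∸_; _≤_; _/_)
open import Data.Product using (_×_)
open import Data.Fin using (Fin)
open import Relation.Binary.PropositionalEquality using (_≡_)

open import Data.Bool using (Bool; true; false; T; _∧_; _∨_; if_then_else_)
open import Data.Bool.Properties using (∨-identityʳ; ∨-comm; ∧-identityʳ; T-∧; T-∨)
open import Data.Empty using (⊥)
open import Data.Fin using (toℕ; fromℕ<) renaming (zero to fzero; suc to fsuc)
open import Data.Fin.Properties using (toℕ<n; toℕ-fromℕ<; fromℕ<-toℕ; toℕ-injective)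
open import Data.List using (foldr; map; allFin)
open import Data.List.Properties using (map-tabulate)
open import Data.Nat
open import Data.Nat.DivMod using (m≡m%n+[m/n]*n; m%n<n; m/n≡1+[m∸n]/n)
open import Data.Nat.Properties
open import Algebra.Properties.CommutativeSemigroup +-commutativeSemigroup using (interchange; xy∙z≈xz∙y)
open import Data.Nat.Tactic.RingSolver using (solve-∀)
open import Data.Product using (_,_; proj₁; proj₂)
open import Data.Sum using (inj₁; inj₂)
open import Data.Unit using (tt)
open import Function using (_∘_)
open import Function.Bundles using (mk⇔; mk↔ₛ′; Equivalence)
open import Function.Construct.Identity using (↔-id)
open import Relation.Binary.Definitions using (tri<; tri≈; tri>)
open import Relation.Binary.PropositionalEquality hiding (J)
open import Relation.Nullary using (proof; yes; no; ofʸ; ofⁿ; ¬_; contradiction)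
open import Relation.Nullary.Decidable using (dec-true; dec-false; does-⇔)

≡ᵇ-true : ∀ {m n} → m ≡ n → (m ≡ᵇ n) ≡ true
≡ᵇ-true {m} {n} = dec-true (m ≟ n)

≡ᵇ-false : ∀ {m n} → m ≢ n → (m ≡ᵇ n) ≡ false
≡ᵇ-false {m} {n} = dec-false (m ≟ n)

≡ᵇ-sym : ∀ m n → (m ≡ᵇ n) ≡ (n ≡ᵇ m)
≡ᵇ-sym m n = does-⇔ (mk⇔ sym sym) (m ≟ n) (n ≟ m)

<ᵇ-true : ∀ {m n} → m < n → (m <ᵇ n) ≡ true
<ᵇ-true {m} {n} = dec-true (m <? n)

<ᵇ-false : ∀ {m n} → ¬ m < n → (m <ᵇ n) ≡ false
<ᵇ-false {m} {n} = dec-false (m <? n)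

T-ext : ∀ {x y} → (T x → T y) → (T y → T x) → x ≡ y
T-ext {true}  {true}  _ _ = refl
T-ext {true}  {false} f _ = contradiction (f tt) λ ()
T-ext {false} {true}  _ g = contradiction (g tt) λ ()
T-ext {false} {false} _ _ = refl

if-∨ : ∀ x y n → (T x → T y → ⊥) → (if x ∨ y then n else 0) ≡ (if x then n else 0) + (if y then n else 0)
if-∨ true  true  n both = contradiction tt (both tt)
if-∨ true  false n _    = sym (+-identityʳ n)
if-∨ false y     n _    = refl

if-*ˡ : ∀ b x → (if b then 1 else 0) * x ≡ (if b then x else 0)
if-*ˡ true  x = +-identityʳ x
if-*ˡ false x = refl

-- Sums over initial segments of ℕ rather than over Fin: vertices are handled by ℕ arithmetic.
∑ : ℕ → (ℕ → ℕ) → ℕ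
∑ zero    f = 0
∑ (suc n) f = ∑ n f + f n

∑-cong : ∀ n {f g : ℕ → ℕ} → (∀ i → i < n → f i ≡ g i) → ∑ n f ≡ ∑ n g
∑-cong zero    f≗g = refl
∑-cong (suc n) f≗g = cong₂ _+_ (∑-cong n λ i i<n → f≗g i (m<n⇒m<1+n i<n)) (f≗g n ≤-refl)

∑-const : ∀ n c → ∑ n (λ _ → c) ≡ n * c
∑-const zero    c = refl
∑-const (suc n) c = trans (cong (_+ c) (∑-const n c)) (+-comm (n * c) c)

∑-const-indicator : ∀ n b → ∑ n (λ _ → if b then 1 else 0) ≡ (if b then n else 0)
∑-const-indicator n true  = trans (∑-const n 1) (*-identityʳ n)
∑-const-indicator n false = trans (∑-const n 0) (*-zeroʳ n)

∑-zero : ∀ n {f : ℕ → ℕ} → (∀ i → i < n → f i ≡ 0) → ∑ n f ≡ 0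
∑-zero n f≗0 = trans (∑-cong n f≗0) (trans (∑-const n 0) (*-zeroʳ n))

∑-+ : ∀ n (f g : ℕ → ℕ) → ∑ n (λ i → f i + g i) ≡ ∑ n f + ∑ n g
∑-+ zero    f g = refl
∑-+ (suc n) f g = trans (cong (_+ (f n + g n)) (∑-+ n f g)) (interchange (∑ n f) (∑ n g) (f n) (g n))

∑-*ʳ : ∀ n (f : ℕ → ℕ) c → ∑ n f * c ≡ ∑ n (λ i → f i * c)
∑-*ʳ zero    f c = refl
∑-*ʳ (suc n) f c = trans (*-distribʳ-+ c (∑ n f) (f n)) (cong (_+ f n * c) (∑-*ʳ n f c))

∑-++ : ∀ m n (f : ℕ → ℕ) → ∑ (m + n) f ≡ ∑ m f + ∑ n (λ i → f (m + i))
∑-++ m zero    f = trans (cong (λ k → ∑ k f) (+-identityʳ m)) (sym (+-identityʳ (∑ m f)))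
∑-++ m (suc n) f = begin
  ∑ (m + suc n) f                           ≡⟨ cong (λ k → ∑ k f) (+-suc m n) ⟩
  ∑ (m + n) f + f (m + n)                   ≡⟨ cong (_+ f (m + n)) (∑-++ m n f) ⟩
  ∑ m f + ∑ n (λ i → f (m + i)) + f (m + n) ≡⟨ +-assoc (∑ m f) _ _ ⟩
  ∑ m f + ∑ (suc n) (λ i → f (m + i))       ∎
  where open ≡-Reasoning

∑-head : ∀ n (f : ℕ → ℕ) → ∑ (suc n) f ≡ f 0 + ∑ n (λ i → f (suc i))
∑-head n f = ∑-++ 1 n f

∑-reverse : ∀ n (f : ℕ → ℕ) → ∑ n f ≡ ∑ n (λ i → f (n ∸ suc i))
∑-reverse zero    f = refl
∑-reverse (suc n) f = begin
  ∑ n f + f n                         ≡⟨ cong (_+ f n) (∑-reverse n f) ⟩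
  ∑ n (λ i → f (n ∸ suc i)) + f n     ≡⟨ +-comm _ (f n) ⟩
  f n + ∑ n (λ i → f (n ∸ suc i))     ≡⟨ ∑-head n (λ i → f (suc n ∸ suc i)) ⟨
  ∑ (suc n) (λ i → f (suc n ∸ suc i)) ∎
  where open ≡-Reasoning

∑-comm : ∀ m n (f : ℕ → ℕ → ℕ) → ∑ m (λ i → ∑ n (f i)) ≡ ∑ n (λ j → ∑ m (λ i → f i j))
∑-comm zero    n f = sym (∑-zero n λ _ _ → refl)
∑-comm (suc m) n f = trans (cong (_+ ∑ n (f m)) (∑-comm m n f)) (sym (∑-+ n _ (f m)))

∑-update : ∀ n {a} {f g : ℕ → ℕ} → a < n → (∀ i → i < n → i ≢ a → f i ≡ g i) → ∑ n f + g a ≡ ∑ n g + f a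
∑-update (suc n) {a} {f} {g} a<1+n f≗g with m<1+n⇒m<n∨m≡n a<1+n
... | inj₁ a<n = begin
  ∑ n f + f n + g a ≡⟨ xy∙z≈xz∙y (∑ n f) _ _ ⟩
  ∑ n f + g a + f n ≡⟨ cong₂ _+_ (∑-update n a<n λ i i<n → f≗g i (m<n⇒m<1+n i<n))
                                (f≗g n ≤-refl λ n≡a → <-irrefl (sym n≡a) a<n) ⟩
  ∑ n g + f a + g n ≡⟨ xy∙z≈xz∙y (∑ n g) _ _ ⟩
  ∑ n g + g n + f a ∎
  where open ≡-Reasoning
... | inj₂ refl = begin
  ∑ n f + f n + g n ≡⟨ cong (λ s → s + f n + g n) (∑-cong n λ i i<n → f≗g i (m<n⇒m<1+n i<n) (<⇒≢ i<n)) ⟩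
  ∑ n g + f n + g n ≡⟨ xy∙z≈xz∙y (∑ n g) _ _ ⟩
  ∑ n g + g n + f n ∎
  where open ≡-Reasoning

∑-pick : ∀ n {a} (f : ℕ → ℕ) → a < n → ∑ n (λ i → if i ≡ᵇ a then f i else 0) ≡ f a
∑-pick n {a} f a<n = begin
  ∑ n F               ≡⟨ +-identityʳ (∑ n F) ⟨
  ∑ n F + 0           ≡⟨ ∑-update n a<n (λ i _ i≢a → cong (if_then f i else 0) (≡ᵇ-false i≢a)) ⟩
  ∑ n (λ _ → 0) + F a ≡⟨ cong₂ _+_ (∑-zero n λ _ _ → refl) (cong (if_then f a else 0) (≡ᵇ-true {a} refl)) ⟩
  f a                 ∎
  where
  open ≡-Reasoning
  F : ℕ → ℕ
  F i = if i ≡ᵇ a then f i else 0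

∑-indicator : ∀ n a x → ∑ n (λ i → if i ≡ᵇ a then x else 0) ≡ (if a <ᵇ n then x else 0)
∑-indicator n a x with a <ᵇ n | proof (a <? n)
... | true  | ofʸ a<n = ∑-pick n (λ _ → x) a<n
... | false | ofⁿ a≮n = ∑-zero n λ i i<n → cong (if_then x else 0) (≡ᵇ-false λ i≡a → a≮n (subst (_< n) i≡a i<n))

∑-mono-≤ : ∀ n {f g : ℕ → ℕ} → (∀ i → i < n → f i ≤ g i) → ∑ n f ≤ ∑ n g
∑-mono-≤ zero    f≤g = z≤n
∑-mono-≤ (suc n) f≤g = +-mono-≤ (∑-mono-≤ n λ i i<n → f≤g i (m<n⇒m<1+n i<n)) (f≤g n ≤-refl)

∑-mono-< : ∀ n {a} {f g : ℕ → ℕ} → a < n → (∀ i → i < n → f i ≤ g i) → f a < g a → ∑ n f < ∑ n g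
∑-mono-< (suc n) {a} a<1+n f≤g fa<ga with m<1+n⇒m<n∨m≡n a<1+n
... | inj₁ a<n  = +-mono-<-≤ (∑-mono-< n a<n (λ i i<n → f≤g i (m<n⇒m<1+n i<n)) fa<ga) (f≤g n ≤-refl)
... | inj₂ refl = +-mono-≤-< (∑-mono-≤ n λ i i<n → f≤g i (m<n⇒m<1+n i<n)) fa<ga

∑-mono-length : ∀ {m n} (f : ℕ → ℕ) → m ≤ n → ∑ m f ≤ ∑ n f
∑-mono-length {m} {n} f m≤n =
  ≤-trans (m≤m+n (∑ m f) _) (≤-reflexive (trans (sym (∑-++ m (n ∸ m) f)) (cong (λ k → ∑ k f) (m+[n∸m]≡n m≤n))))

-- Junk value 0 outside Fin n.
onℕ : ∀ {n} → (Fin n → ℕ) → ℕ → ℕ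
onℕ {n} f u with u <? n
... | yes u<n = f (fromℕ< u<n)
... | no  _   = 0

onℕ-toℕ : ∀ {n} (f : Fin n → ℕ) i → onℕ f (toℕ i) ≡ f i
onℕ-toℕ {n} f i with toℕ i <? n
... | yes i<n = cong f (fromℕ<-toℕ i i<n)
... | no  i≮n = contradiction (toℕ<n i) i≮n

foldr-allFin : ∀ {n} (_∙_ : ℕ → ℕ → ℕ) e (f : Fin (suc n) → ℕ) →
               foldr _∙_ e (map f (allFin (suc n))) ≡ f fzero ∙ foldr _∙_ e (map (f ∘ fsuc) (allFin n))
foldr-allFin {n} _∙_ e f =
  cong (λ xs → f fzero ∙ foldr _∙_ e xs) (trans (map-tabulate fsuc f) (sym (map-tabulate (λ i → i) (f ∘ fsuc))))

sumFin≡∑ : ∀ {n} (f : Fin n → ℕ) (g : ℕ → ℕ) → (∀ i → f i ≡ g (toℕ i)) → sumFin f ≡ ∑ n g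
sumFin≡∑ {zero}  f g f≗g = refl
sumFin≡∑ {suc n} f g f≗g = begin
  sumFin f                    ≡⟨ foldr-allFin _+_ 0 f ⟩
  f fzero + sumFin (f ∘ fsuc) ≡⟨ cong₂ _+_ (f≗g fzero) (sumFin≡∑ (f ∘ fsuc) (g ∘ suc) (f≗g ∘ fsuc)) ⟩
  g 0 + ∑ n (g ∘ suc)         ≡⟨ ∑-head n g ⟨
  ∑ (suc n) g                 ∎
  where open ≡-Reasoning

≤-maxFin : ∀ {n} (f : Fin n → ℕ) i → f i ≤ maxFin f
≤-maxFin f fzero    = ≤-trans (m≤m⊔n _ _) (≤-reflexive (sym (foldr-allFin _⊔_ 0 f)))
≤-maxFin f (fsuc i) = ≤-trans (≤-maxFin (f ∘ fsuc) i) (≤-trans (m≤n⊔m _ _) (≤-reflexive (sym (foldr-allFin _⊔_ 0 f))))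

maxFin-lub : ∀ {n} (f : Fin n → ℕ) m → (∀ i → f i ≤ m) → maxFin f ≤ m
maxFin-lub {zero}  f m f≤m = z≤n
maxFin-lub {suc n} f m f≤m =
  ≤-trans (≤-reflexive (foldr-allFin _⊔_ 0 f)) (⊔-lub (f≤m fzero) (maxFin-lub (f ∘ fsuc) m (f≤m ∘ fsuc)))

module NatGraph (n : ℕ) (A : ℕ → ℕ → Bool) where

  graph : Graph n
  graph = record { adj = λ i j → A (toℕ i) (toℕ j) }

  nbrΣ : ℕ → (ℕ → ℕ) → ℕ
  nbrΣ u g = ∑ n (λ w → if A u w then g w else 0)

  degree : ℕ → ℕ
  degree u = nbrΣ u (λ _ → 1)

  IsHittingColumn : (ℕ → ℕ) → ℕ → Set
  IsHittingColumn h v = h v ≡ 0 × (∀ u → u < n → u ≢ v → degree u * h u ≡ degree u + nbrΣ u h)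

  column : (Fin n → Fin n → ℕ) → Fin n → ℕ → ℕ
  column H v = onℕ (λ u → H u v)

  deg≡degree : ∀ i → deg graph i ≡ degree (toℕ i)
  deg≡degree i = sumFin≡∑ {n} _ _ λ _ → refl

  nbrSum≡nbrΣ : ∀ i f → nbrSum graph i f ≡ nbrΣ (toℕ i) (onℕ f)
  nbrSum≡nbrΣ i f = sumFin≡∑ {n} _ _ λ w → cong (if A (toℕ i) (toℕ w) then_else 0) (sym (onℕ-toℕ f w))

  hittingColumn : ∀ {H} → IsHittingTime graph H → ∀ v → IsHittingColumn (column H v) (toℕ v)
  hittingColumn {H} (H-diag , H-step) v = trans (onℕ-toℕ _ v) (H-diag v) , column-step
    where
    h = column H v
    step-at : ∀ i → i ≢ v → degree (toℕ i) * h (toℕ i) ≡ degree (toℕ i) + nbrΣ (toℕ i) h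
    step-at i i≢v = begin
      degree (toℕ i) * h (toℕ i)                 ≡⟨ cong₂ _*_ (sym (deg≡degree i)) (onℕ-toℕ _ i) ⟩
      deg graph i * H i v                        ≡⟨ H-step i v i≢v ⟩
      deg graph i + nbrSum graph i (λ w → H w v) ≡⟨ cong₂ _+_ (deg≡degree i) (nbrSum≡nbrΣ i _) ⟩
      degree (toℕ i) + nbrΣ (toℕ i) h            ∎
      where open ≡-Reasoning
    column-step : ∀ u → u < n → u ≢ toℕ v → degree u * h u ≡ degree u + nbrΣ u h
    column-step u u<n u≢v = subst (λ x → degree x * h x ≡ degree x + nbrΣ x h) (toℕ-fromℕ< u<n)
      (step-at (fromℕ< u<n) λ i≡v → u≢v (trans (sym (toℕ-fromℕ< u<n)) (cong toℕ i≡v)))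

  joining≡∑ : ∀ H v → joining graph H v ≡ ∑ n (λ u → degree u * column H v u)
  joining≡∑ H v = sumFin≡∑ {n} _ _ λ u → cong₂ _*_ (deg≡degree u) (sym (onℕ-toℕ _ u))

  -- Summing the first-step equations over u ≢ v, every h w is counted deg w times on both sides
  -- except for the neighbours of v, which leaves Kac's return-time formula.
  kac : (∀ u w → A u w ≡ A w u) → ∀ {h v} → v < n → IsHittingColumn h v → degree v + nbrΣ v h ≡ ∑ n degree
  kac A-sym {h} {v} v<n (h-v , h-step) = +-cancelˡ-≡ (∑ n F) _ _ (begin
    ∑ n F + (degree v + nbrΣ v h)     ≡⟨ ∑-update n v<n h-step ⟩
    ∑ n E + F v                       ≡⟨ cong (∑ n E +_) (trans (cong (degree v *_) h-v) (*-zeroʳ (degree v))) ⟩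
    ∑ n E + 0                         ≡⟨ +-identityʳ _ ⟩
    ∑ n E                             ≡⟨ ∑-+ n degree (λ u → nbrΣ u h) ⟩
    ∑ n degree + ∑ n (λ u → nbrΣ u h) ≡⟨ cong (∑ n degree +_) double-count ⟩
    ∑ n degree + ∑ n F                ≡⟨ +-comm (∑ n degree) _ ⟩
    ∑ n F + ∑ n degree                ∎)
    where
    open ≡-Reasoning
    F E : ℕ → ℕ
    F u = degree u * h u
    E u = degree u + nbrΣ u h
    double-count : ∑ n (λ u → nbrΣ u h) ≡ ∑ n F
    double-count = begin
      ∑ n (λ u → ∑ n (λ w → if A u w then h w else 0))       ≡⟨ ∑-comm n n _ ⟩
      ∑ n (λ w → ∑ n (λ u → if A u w then h w else 0))       ≡⟨ ∑-cong n (λ w _ → ∑-cong n λ u _ → trans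
                                                                  (cong (if_then h w else 0) (A-sym u w)) (sym (if-*ˡ (A w u) (h w)))) ⟩
      ∑ n (λ w → ∑ n (λ u → (if A w u then 1 else 0) * h w)) ≡⟨ ∑-cong n (λ w _ → sym (∑-*ʳ n _ (h w))) ⟩
      ∑ n F                                                   ∎

module _ {n : ℕ} (A A′ : ℕ → ℕ → Bool) (σ : ℕ → ℕ) (σ<n : ∀ {u} → u < n → σ u < n)
         (σ-involutive : ∀ {u} → u < n → σ (σ u) ≡ u)
         (σ-adj : ∀ {a b} → a < n → b < n → A a b ≡ A′ (σ a) (σ b)) where

  ≅-by-involution : NatGraph.graph n A ≅ NatGraph.graph n A′
  ≅-by-involution = mk↔ₛ′ f f f∘f f∘f , λ a b →
    trans (σ-adj (toℕ<n a) (toℕ<n b)) (sym (cong₂ A′ (toℕ-f a) (toℕ-f b)))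
    where
    f : Fin n → Fin n
    f i = fromℕ< (σ<n (toℕ<n i))
    toℕ-f : ∀ i → toℕ (f i) ≡ σ (toℕ i)
    toℕ-f i = toℕ-fromℕ< (σ<n (toℕ<n i))
    f∘f : ∀ i → f (f i) ≡ i
    f∘f i = toℕ-injective (trans (toℕ-f (f i)) (trans (cong σ (toℕ-f i)) (σ-involutive (toℕ<n i))))

-- Walks on a weighted path

pre : (ℕ → ℕ) → ℕ → ℕ
pre w e = ∑ (suc e) w

∑pre² : (ℕ → ℕ) → ℕ → ℕ
∑pre² w m = ∑ m (λ e → pre w e * pre w e)

-- First-step equations of the path 0, 1, 2, … towards a target on the right, where the vertex
-- weights w account for everything hanging off the path.
PathEq : (w h : ℕ → ℕ) → ℕ → Set
PathEq w h zero    = h 0 ≡ w 0 + h 1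
PathEq w h (suc i) = 2 * h (suc i) ≡ w (suc i) + (h (suc (suc i)) + h i)

PathEq⇒crossing : ∀ {w h : ℕ → ℕ} {j} → (∀ i → i < j → PathEq w h i) → ∀ e → e < j → h e ≡ h (suc e) + pre w e
PathEq⇒crossing {w} {h} eqs zero    0<j   = trans (eqs 0 0<j) (+-comm (w 0) (h 1))
PathEq⇒crossing {w} {h} eqs (suc e) 1+e<j = cancel (h (suc e)) (h (suc (suc e))) (pre w e) (w (suc e))
  (trans (eqs (suc e) 1+e<j) (cong (λ x → w (suc e) + (h (suc (suc e)) + x)) (PathEq⇒crossing eqs e (<-trans (n<1+n e) 1+e<j))))
  where
  cancel : ∀ a b P x → 2 * a ≡ x + (b + (a + P)) → a ≡ b + (P + x)
  cancel a b P x eq = +-cancelˡ-≡ a _ _ (trans (double a) (trans eq (shuffle a b P x)))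
    where
    double : ∀ a → a + a ≡ 2 * a
    double = solve-∀
    shuffle : ∀ a b P x → x + (b + (a + P)) ≡ a + (b + (P + x))
    shuffle = solve-∀

∑-by-parts : ∀ {w h : ℕ → ℕ} m → (∀ e → e < m → h e ≡ h (suc e) + pre w e) →
             ∑ m (λ i → w i * h i) ≡ ∑ m w * h m + ∑pre² w m
∑-by-parts zero    _    = refl
∑-by-parts {w} {h} (suc m) crossing = begin
  ∑ m (λ i → w i * h i) + w m * h m
    ≡⟨ cong (_+ w m * h m) (∑-by-parts {w} {h} m λ e e<m → crossing e (m<n⇒m<1+n e<m)) ⟩
  ∑ m w * h m + ∑pre² w m + w m * h m
    ≡⟨ cong (λ y → ∑ m w * y + ∑pre² w m + w m * y) (crossing m ≤-refl) ⟩
  ∑ m w * (h (suc m) + pre w m) + ∑pre² w m + w m * (h (suc m) + pre w m)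
    ≡⟨ regroup (∑ m w) (w m) (∑pre² w m) (h (suc m)) ⟩
  pre w m * h (suc m) + ∑pre² w (suc m)
    ∎
  where
  open ≡-Reasoning
  regroup : ∀ W x S y → W * (y + (W + x)) + S + x * (y + (W + x)) ≡ (W + x) * y + (S + (W + x) * (W + x))
  regroup = solve-∀

split-around : ∀ D j (f : ℕ → ℕ) → j ≤ D → ∑ (suc D) f ≡ ∑ j f + f j + ∑ (D ∸ j) (λ i → f (D ∸ i))
split-around D j f j≤D = begin
  ∑ (suc D) f
    ≡⟨ cong (λ n → ∑ n f) (trans (+-suc j (D ∸ j)) (cong suc (m+[n∸m]≡n j≤D))) ⟨
  ∑ (j + suc (D ∸ j)) f
    ≡⟨ trans (∑-++ j (suc (D ∸ j)) f) (cong (∑ j f +_) (∑-head (D ∸ j) _)) ⟩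
  ∑ j f + (f (j + 0) + ∑ (D ∸ j) (λ i → f (j + suc i)))
    ≡⟨ sym (+-assoc (∑ j f) _ _) ⟩
  ∑ j f + f (j + 0) + ∑ (D ∸ j) (λ i → f (j + suc i))
    ≡⟨ cong₂ (λ x y → ∑ j f + f x + y) (+-identityʳ j) (sym right-half) ⟩
  ∑ j f + f j + ∑ (D ∸ j) (λ i → f (D ∸ i))
    ∎
  where
  open ≡-Reasoning
  right-half : ∑ (D ∸ j) (λ i → f (D ∸ i)) ≡ ∑ (D ∸ j) (λ i → f (j + suc i))
  right-half = trans (∑-reverse (D ∸ j) _) (∑-cong (D ∸ j) λ i i<D∸j → cong f (begin
    D ∸ (D ∸ j ∸ suc i)   ≡⟨ cong (D ∸_) (∸-+-assoc D j (suc i)) ⟩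
    D ∸ (D ∸ (j + suc i)) ≡⟨ m∸[m∸n]≡n (≤-trans (+-monoʳ-≤ j i<D∸j) (≤-reflexive (m+[n∸m]≡n j≤D))) ⟩
    j + suc i             ∎))

∑-by-parts-around : ∀ D j {w w* h : ℕ → ℕ} → j ≤ D →
  (∀ i → i < D ∸ j → w* i ≡ w (D ∸ i)) →
  (∀ i → i < j → PathEq w h i) →
  (∀ i → i < D ∸ j → PathEq w* (h ∘ (D ∸_)) i) →
  ∑ (suc D) (λ i → w i * h i) ≡ ∑ (suc D) w * h j + (∑pre² w j + ∑pre² w* (D ∸ j))
∑-by-parts-around D j {w} {w*} {h} j≤D w*≡ left-eqs right-eqs = begin
  ∑ (suc D) (λ i → w i * h i)
    ≡⟨ split-around D j _ j≤D ⟩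
  ∑ j (λ i → w i * h i) + w j * h j + ∑ (D ∸ j) (λ i → w (D ∸ i) * h (D ∸ i))
    ≡⟨ cong₂ (λ x y → x + w j * h j + y) left-sum right-sum ⟩
  ∑ j w * h j + ∑pre² w j + w j * h j + (∑ (D ∸ j) w* * h j + ∑pre² w* (D ∸ j))
    ≡⟨ regroup (∑ j w) (w j) (∑ (D ∸ j) w*) (h j) _ _ ⟩
  (∑ j w + w j + ∑ (D ∸ j) w*) * h j + (∑pre² w j + ∑pre² w* (D ∸ j))
    ≡⟨ cong (λ W → W * h j + (∑pre² w j + ∑pre² w* (D ∸ j))) total ⟨
  ∑ (suc D) w * h j + (∑pre² w j + ∑pre² w* (D ∸ j))
    ∎
  where
  open ≡-Reasoning
  left-sum : ∑ j (λ i → w i * h i) ≡ ∑ j w * h j + ∑pre² w j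
  left-sum = ∑-by-parts {w} {h} j (PathEq⇒crossing left-eqs)
  right-sum : ∑ (D ∸ j) (λ i → w (D ∸ i) * h (D ∸ i)) ≡ ∑ (D ∸ j) w* * h j + ∑pre² w* (D ∸ j)
  right-sum = begin
    ∑ (D ∸ j) (λ i → w (D ∸ i) * h (D ∸ i))
      ≡⟨ ∑-cong (D ∸ j) (λ i i<D∸j → cong (_* h (D ∸ i)) (w*≡ i i<D∸j)) ⟨
    ∑ (D ∸ j) (λ i → w* i * h (D ∸ i))
      ≡⟨ ∑-by-parts {w*} {h ∘ (D ∸_)} (D ∸ j) (PathEq⇒crossing right-eqs) ⟩
    ∑ (D ∸ j) w* * h (D ∸ (D ∸ j)) + ∑pre² w* (D ∸ j)
      ≡⟨ cong (λ y → ∑ (D ∸ j) w* * h y + ∑pre² w* (D ∸ j)) (m∸[m∸n]≡n j≤D) ⟩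
    ∑ (D ∸ j) w* * h j + ∑pre² w* (D ∸ j)
      ∎
  total : ∑ (suc D) w ≡ ∑ j w + w j + ∑ (D ∸ j) w*
  total = trans (split-around D j w j≤D) (cong (∑ j w + w j +_) (sym (∑-cong (D ∸ j) w*≡)))
  regroup : ∀ a b c y A B → a * y + A + b * y + (c * y + B) ≡ (a + b + c) * y + (A + B)
  regroup = solve-∀

-- Maxima of valley-shaped and antitone sequences

max-at-ends : ∀ n (a b P : ℕ → ℕ) → (∀ j → a j ≤ a (suc j)) → (∀ j → b (suc j) ≤ b j) →
              (∀ j → j < n → P (suc j) + b j ≡ P j + a j) → ∀ j → j ≤ n → P j ≤ P 0 ⊔ P n
max-at-ends n a b P a-mono b-anti step = bound
  where
  down : ∀ j → j < n → a j ≤ b j → P (suc j) ≤ P j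
  down j j<n a≤b = +-cancelʳ-≤ (b j) _ _ (≤-trans (≤-reflexive (step j j<n)) (+-monoʳ-≤ (P j) a≤b))
  up : ∀ j → j < n → b j ≤ a j → P j ≤ P (suc j)
  up j j<n b≤a = +-cancelʳ-≤ (b j) _ _ (≤-trans (+-monoʳ-≤ (P j) b≤a) (≤-reflexive (sym (step j j<n))))
  descend : ∀ j → j < n → a j ≤ b j → P (suc j) ≤ P 0
  descend zero    j<n a≤b = down 0 j<n a≤b
  descend (suc j) j<n a≤b =
    ≤-trans (down (suc j) j<n a≤b) (descend j (<-trans (n<1+n j) j<n) (≤-trans (a-mono j) (≤-trans a≤b (b-anti j))))
  ascend : ∀ t j → j + t ≡ n → b j ≤ a j → P j ≤ P n
  ascend zero    j j+0≡n _   = ≤-reflexive (cong P (trans (sym (+-identityʳ j)) j+0≡n))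
  ascend (suc t) j j+t≡n b≤a = ≤-trans (up j (<-≤-trans (m<m+n j z<s) (≤-reflexive j+t≡n)) b≤a)
    (ascend t (suc j) (trans (sym (+-suc j t)) j+t≡n) (≤-trans (b-anti j) (≤-trans b≤a (a-mono j))))
  bound : ∀ j → j ≤ n → P j ≤ P 0 ⊔ P n
  bound zero    _     = m≤m⊔n _ _
  bound (suc j) 1+j≤n with a j ≤? b j
  ... | yes a≤b = ≤-trans (descend j 1+j≤n a≤b) (m≤m⊔n _ _)
  ... | no  a≰b = ≤-trans (ascend (n ∸ suc j) (suc j) (m+[n∸m]≡n 1+j≤n)
                                  (≤-trans (b-anti j) (≤-trans (<⇒≤ (≰⇒> a≰b)) (a-mono j))))
                          (m≤n⊔m _ _)

module Midpoint (f : ℕ → ℕ) (f-anti : ∀ {q q′} → q ≤ q′ → f q′ ≤ f q)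
                {D c : ℕ} (c≤D∸c : c ≤ D ∸ c) (D∸c≤1+c : D ∸ c ≤ suc c) where

  c≤D : c ≤ D
  c≤D = ≤-trans c≤D∸c (m∸n≤m D c)

  max-at-midpoint : f (D ∸ c) ⊔ f c ≡ f c
  max-at-midpoint = m≤n⇒m⊔n≡n (f-anti c≤D∸c)

  midpoint-minimises : ∀ q → q ≤ D → f (D ∸ c) ⊔ f c ≤ f (D ∸ q) ⊔ f q
  midpoint-minimises q q≤D rewrite max-at-midpoint with q ≤? c
  ... | yes q≤c = ≤-trans (f-anti q≤c) (m≤n⊔m _ _)
  ... | no  q≰c = ≤-trans (f-anti D∸q≤c) (m≤m⊔n _ _)
    where
    D∸q≤c : D ∸ q ≤ c
    D∸q≤c = ≤-trans (∸-monoʳ-≤ D (≤-trans D∸c≤1+c (≰⇒> q≰c))) (≤-reflexive (m∸[m∸n]≡n c≤D))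

  midpoint-unique : (∀ {q q′} → q < q′ → q < D → f q′ < f q) →
                    ∀ q → q ≤ D → q ≢ c → q ≢ D ∸ c → f (D ∸ c) ⊔ f c < f (D ∸ q) ⊔ f q
  midpoint-unique f-strict q q≤D q≢c q≢D∸c rewrite max-at-midpoint with <-cmp q c
  ... | tri< q<c _ _ = <-≤-trans (f-strict q<c (<-≤-trans q<c c≤D)) (m≤n⊔m _ _)
  ... | tri≈ _ q≡c _ = contradiction q≡c q≢c
  ... | tri> _ _ c<q = <-≤-trans (f-strict D∸q<c (<-≤-trans D∸q<c c≤D)) (m≤m⊔n _ _)
    where
    D∸c<q : D ∸ c < q
    D∸c<q = ≤∧≢⇒< (≤-trans D∸c≤1+c c<q) (q≢D∸c ∘ sym)
    D∸q<c : D ∸ q < c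
    D∸q<c = <-≤-trans (∸-monoʳ-< D∸c<q q≤D) (≤-reflexive (m∸[m∸n]≡n c≤D))

half-midpoint : ∀ D → D / 2 ≤ D ∸ D / 2 × D ∸ D / 2 ≤ suc (D / 2)
half-midpoint D = subst (D / 2 ≤_) (sym D∸c≡c+r) (m≤m+n (D / 2) (D % 2))
         , subst (_≤ suc (D / 2)) (sym D∸c≡c+r)
                 (≤-trans (+-monoʳ-≤ (D / 2) (≤-pred (m%n<n D 2))) (≤-reflexive (+-comm (D / 2) 1)))
  where
  split : ∀ r c → r + c * 2 ≡ c + (c + r)
  split = solve-∀
  D∸c≡c+r : D ∸ D / 2 ≡ D / 2 + D % 2
  D∸c≡c+r = trans (cong (_∸ D / 2) (trans (m≡m%n+[m/n]*n D 2) (split (D % 2) (D / 2)))) (m+n∸m≡n (D / 2) (D / 2 + D % 2))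

-- The spine v_1 … v_{d-1}, numbered 0 … D, and its weights

module Spine (D : ℕ) where

  pathNbrs : ℕ → (ℕ → ℕ) → ℕ
  pathNbrs i g = (if i <ᵇ D then g (suc i) else 0) + (if 0 <ᵇ i then g (pred i) else 0)

  pathDeg : ℕ → ℕ
  pathDeg i = pathNbrs i (λ _ → 1)

  -- The first-step equation at spine vertex i once every pendant leaf x of i has been eliminated
  -- through h x = h i + 1; the weight w i is then the total degree of i and its leaves.
  Balanced : (w h : ℕ → ℕ) → ℕ → Set
  Balanced w h i = pathDeg i * h i ≡ w i + pathNbrs i h

  balanced⇒PathEq : ∀ {w h : ℕ → ℕ} i → i < D → Balanced w h i → PathEq w h i
  balanced⇒PathEq {w} {h} zero 0<D eq rewrite <ᵇ-true 0<D =
    trans (sym (+-identityʳ (h 0))) (trans eq (cong (w 0 +_) (+-identityʳ (h 1))))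
  balanced⇒PathEq (suc i) 1+i<D eq rewrite <ᵇ-true 1+i<D = eq

  pathNbrs-reflect : ∀ {i} (g : ℕ → ℕ) → i ≤ D → pathNbrs (D ∸ i) g ≡ pathNbrs i (g ∘ (D ∸_))
  pathNbrs-reflect {i} g i≤D =
    trans (+-comm (if D ∸ i <ᵇ D then g (suc (D ∸ i)) else 0) _) (cong₂ _+_ (towards-0 i≤D) (towards-D i≤D))
    where
    towards-0 : ∀ {i} → i ≤ D → (if 0 <ᵇ D ∸ i then g (pred (D ∸ i)) else 0) ≡ (if i <ᵇ D then g (D ∸ suc i) else 0)
    towards-0 {i} i≤D with m≤n⇒m<n∨m≡n i≤D
    ... | inj₁ i<D  rewrite <ᵇ-true (m<n⇒0<n∸m i<D) | <ᵇ-true i<D = cong g (pred[m∸n]≡m∸[1+n] D i)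
    ... | inj₂ refl rewrite n∸n≡0 D | <ᵇ-false (<-irrefl {D} refl) = refl
    towards-D : ∀ {i} → i ≤ D → (if D ∸ i <ᵇ D then g (suc (D ∸ i)) else 0) ≡ (if 0 <ᵇ i then g (D ∸ pred i) else 0)
    towards-D {zero}  _   rewrite <ᵇ-false (<-irrefl {D} refl) = refl
    towards-D {suc j} j<D rewrite <ᵇ-true (∸-monoʳ-< {D} (z<s {j}) j<D) = cong g (sym (+-∸-assoc 1 j<D))

  balanced-reflect : ∀ {w h : ℕ → ℕ} {i} → i ≤ D → Balanced w h (D ∸ i) → Balanced (w ∘ (D ∸_)) (h ∘ (D ∸_)) i
  balanced-reflect {w} {h} {i} i≤D =
    subst₂ (λ δ P → δ * h (D ∸ i) ≡ w (D ∸ i) + P) (pathNbrs-reflect (λ _ → 1) i≤D) (pathNbrs-reflect h i≤D)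

module Weights (D ℓ : ℕ) where
  open Spine D

  ends : ℕ → ℕ
  ends i = (if i ≡ᵇ 0 then ℓ else 0) + (if i ≡ᵇ D then ℓ else 0)

  pendantCount : ℕ → ℕ → ℕ
  pendantCount q i = ends i + (if i ≡ᵇ q then 1 else 0)

  weight : ℕ → ℕ → ℕ
  weight q i = pathDeg i + pendantCount q i + pendantCount q i

  weight₀ : ℕ → ℕ
  weight₀ i = pathDeg i + ends i + ends i

  weight-singleton : ∀ q i → weight q i ≡ weight₀ i + (if i ≡ᵇ q then 2 else 0)
  weight-singleton q i = trans (regroup (pathDeg i) (ends i) _) (cong (weight₀ i +_) (double (i ≡ᵇ q)))
    where
    regroup : ∀ a e x → a + (e + x) + (e + x) ≡ a + e + e + (x + x)
    regroup = solve-∀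
    double : ∀ b → (if b then 1 else 0) + (if b then 1 else 0) ≡ (if b then 2 else 0)
    double true  = refl
    double false = refl

  reflect-≡ᵇ : ∀ {i q} → i ≤ D → q ≤ D → (D ∸ i ≡ᵇ q) ≡ (i ≡ᵇ D ∸ q)
  reflect-≡ᵇ {i} {q} i≤D q≤D = does-⇔ (mk⇔ to from) (D ∸ i ≟ q) (i ≟ D ∸ q)
    where
    to : D ∸ i ≡ q → i ≡ D ∸ q
    to e = trans (sym (m∸[m∸n]≡n i≤D)) (cong (D ∸_) e)
    from : i ≡ D ∸ q → D ∸ i ≡ q
    from e = trans (cong (D ∸_) e) (m∸[m∸n]≡n q≤D)

  ends-reflect : ∀ {i} → i ≤ D → ends (D ∸ i) ≡ ends i
  ends-reflect {i} i≤D = trans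
    (cong₂ (λ b b′ → (if b then ℓ else 0) + (if b′ then ℓ else 0))
           (reflect-≡ᵇ i≤D z≤n) (trans (reflect-≡ᵇ i≤D ≤-refl) (cong (i ≡ᵇ_) (n∸n≡0 D))))
    (+-comm (if i ≡ᵇ D then ℓ else 0) _)

  weight-reflect : ∀ {q i} → q ≤ D → i ≤ D → weight q (D ∸ i) ≡ weight (D ∸ q) i
  weight-reflect {q} {i} q≤D i≤D = cong₂ (λ δ c → δ + c + c) (pathNbrs-reflect (λ _ → 1) i≤D)
    (cong₂ _+_ (ends-reflect i≤D) (cong (if_then 1 else 0) (reflect-≡ᵇ i≤D q≤D)))

  pre-weight : ∀ q e → pre (weight q) e ≡ pre weight₀ e + (if q <ᵇ suc e then 2 else 0)
  pre-weight q e = begin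
    ∑ (suc e) (weight q)                                      ≡⟨ ∑-cong (suc e) (λ i _ → weight-singleton q i) ⟩
    ∑ (suc e) (λ i → weight₀ i + (if i ≡ᵇ q then 2 else 0))   ≡⟨ ∑-+ (suc e) weight₀ _ ⟩
    pre weight₀ e + ∑ (suc e) (λ i → if i ≡ᵇ q then 2 else 0) ≡⟨ cong (pre weight₀ e +_) (∑-indicator (suc e) q 2) ⟩
    pre weight₀ e + (if q <ᵇ suc e then 2 else 0)             ∎
    where open ≡-Reasoning

  -- 2|E| − 1
  Q : ℕ
  Q = suc (∑ (suc D) weight₀)

  total-weight : ∀ {q} → q ≤ D → ∑ (suc D) (weight q) ≡ suc Q
  total-weight {q} q≤D = trans (pre-weight q D)
    (trans (cong (λ b → ∑ (suc D) weight₀ + (if b then 2 else 0)) (<ᵇ-true (s≤s q≤D))) (+-comm (∑ (suc D) weight₀) 2))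

  pre-weight-anti : ∀ {q q′} e → q ≤ q′ → pre (weight q′) e ≤ pre (weight q) e
  pre-weight-anti {q} {q′} e q≤q′ rewrite pre-weight q′ e | pre-weight q e = +-monoʳ-≤ (pre weight₀ e) bonus
    where
    bonus : (if q′ <ᵇ suc e then 2 else 0) ≤ (if q <ᵇ suc e then 2 else 0)
    bonus with q′ <ᵇ suc e | proof (q′ <? suc e)
    ... | true  | ofʸ q′≤e rewrite <ᵇ-true (≤-<-trans q≤q′ q′≤e) = ≤-refl
    ... | false | ofⁿ _    = z≤n

  -- The sum over the spine edges of the squared crossing time towards spine vertex j.
  spineCost : ℕ → ℕ → ℕ
  spineCost q j = ∑pre² (weight q) j + ∑pre² (weight (D ∸ q)) (D ∸ j)

  endCost : ℕ → ℕ
  endCost q = ∑pre² (weight q) D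

  spineCost-D : ∀ q → spineCost q D ≡ endCost q
  spineCost-D q = trans (cong (λ m → endCost q + ∑pre² (weight (D ∸ q)) m) (n∸n≡0 D)) (+-identityʳ (endCost q))

  endCost-anti : ∀ {q q′} → q ≤ q′ → endCost q′ ≤ endCost q
  endCost-anti q≤q′ = ∑-mono-≤ D λ e _ → *-mono-≤ (pre-weight-anti e q≤q′) (pre-weight-anti e q≤q′)

  endCost-strict : ∀ {q q′} → q < q′ → q < D → endCost q′ < endCost q
  endCost-strict {q} {q′} q<q′ q<D =
    ∑-mono-< D q<D (λ e _ → *-mono-≤ (pre-weight-anti e (<⇒≤ q<q′)) (pre-weight-anti e (<⇒≤ q<q′))) (*-mono-< gap gap)
    where
    gap : pre (weight q′) q < pre (weight q) q
    gap rewrite pre-weight q′ q | pre-weight q q | <ᵇ-false (<⇒≱ q<q′ ∘ ≤-pred) | <ᵇ-true (n<1+n q) =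
      +-monoʳ-< (pre weight₀ q) (s≤s z≤n)

  spineCost-valley : ∀ q j → j ≤ D → spineCost q j ≤ spineCost q 0 ⊔ spineCost q D
  spineCost-valley q = max-at-ends D a b (spineCost q) a-mono b-anti step
    where
    a b : ℕ → ℕ
    a e = pre (weight q) e * pre (weight q) e
    b e = pre (weight (D ∸ q)) (D ∸ suc e) * pre (weight (D ∸ q)) (D ∸ suc e)
    pre²-mono : ∀ w {x y} → x ≤ y → pre w x * pre w x ≤ pre w y * pre w y
    pre²-mono w x≤y = *-mono-≤ (∑-mono-length w (s≤s x≤y)) (∑-mono-length w (s≤s x≤y))
    a-mono : ∀ e → a e ≤ a (suc e)
    a-mono e = pre²-mono (weight q) (n≤1+n e)
    b-anti : ∀ e → b (suc e) ≤ b e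
    b-anti e = pre²-mono (weight (D ∸ q)) (∸-monoʳ-≤ D (n≤1+n (suc e)))
    step : ∀ j → j < D → spineCost q (suc j) + b j ≡ spineCost q j + a j
    step j j<D rewrite +-∸-assoc 1 j<D = shuffle (∑pre² (weight q) j) (a j) (∑pre² (weight (D ∸ q)) (D ∸ suc j)) (b j)
      where
      shuffle : ∀ S x T y → S + x + T + y ≡ S + (T + y) + x
      shuffle = solve-∀

-- The near double broom

module Layout (D ℓ : ℕ) where

  L0 R0 Z leafCount N : ℕ
  L0 = suc D
  R0 = L0 + ℓ
  Z = R0 + ℓ
  leafCount = suc (ℓ + ℓ)
  N = suc (suc D) + (ℓ + ℓ)

  N≡1+Z : N ≡ suc Z
  N≡1+Z = cong (suc ∘ suc) (sym (+-assoc D ℓ ℓ))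

  Z<N : Z < N
  Z<N = ≤-reflexive (sym N≡1+Z)

  1+spine<N : ∀ {i} → i ≤ D → suc i < N
  1+spine<N i≤D = ≤-trans (s≤s (s≤s i≤D)) (m≤m+n (suc (suc D)) (ℓ + ℓ))

  spine<N : ∀ {i} → i ≤ D → i < N
  spine<N i≤D = <-trans (n<1+n _) (1+spine<N i≤D)

  L0+x<N : ∀ {x} → x < leafCount → L0 + x < N
  L0+x<N x<leafCount = <-≤-trans (+-monoʳ-< L0 x<leafCount) (≤-reflexive (+-suc L0 (ℓ + ℓ)))

  vertices-split : ∀ f → ∑ N f ≡ ∑ (suc D) f + ∑ leafCount (λ x → f (L0 + x))
  vertices-split f = trans (cong (λ n → ∑ n f) (sym (+-suc L0 (ℓ + ℓ)))) (∑-++ L0 leafCount f)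

  leaves-split : ∀ f → ∑ leafCount (λ x → f (L0 + x)) ≡ ∑ ℓ (λ x → f (L0 + x)) + ∑ ℓ (λ x → f (R0 + x)) + f Z
  leaves-split f = cong₂ _+_
    (trans (∑-++ ℓ ℓ _) (cong (∑ ℓ (λ x → f (L0 + x)) +_) (∑-cong ℓ λ x _ → cong f (sym (+-assoc L0 ℓ x)))))
    (cong f (sym (+-assoc L0 ℓ ℓ)))

  data Position (u : ℕ) : Set where
    spine : u ≤ D → Position u
    left  : L0 ≤ u → u < R0 → Position u
    right : R0 ≤ u → u < Z → Position u
    spike : u ≡ Z → Position u

  position : ∀ {u} → u < N → Position u
  position {u} u<N with u ≤? D
  ... | yes u≤D = spine u≤D
  ... | no  u≰D with u <? R0
  ...   | yes u<R0 = left (≰⇒> u≰D) u<R0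
  ...   | no  u≮R0 with u <? Z
  ...     | yes u<Z = right (≮⇒≥ u≮R0) u<Z
  ...     | no  u≮Z = spike (≤-antisym (≤-pred (≤-trans u<N (≤-reflexive N≡1+Z))) (≮⇒≥ u≮Z))

  byPosition : ∀ {A : Set} → ℕ → (onSpine onLeft onRight onSpike : A) → A
  byPosition u s l r z = if u <ᵇ L0 then s else if u <ᵇ R0 then l else if u <ᵇ Z then r else z

  module _ {A : Set} {s l r z : A} where

    byPosition-spine : ∀ {u} → u ≤ D → byPosition u s l r z ≡ s
    byPosition-spine u≤D rewrite <ᵇ-true (s≤s u≤D) = refl

    byPosition-left : ∀ {u} → L0 ≤ u → u < R0 → byPosition u s l r z ≡ l
    byPosition-left L0≤u u<R0 rewrite <ᵇ-false (≤⇒≯ L0≤u) | <ᵇ-true u<R0 = refl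

    byPosition-right : ∀ {u} → R0 ≤ u → u < Z → byPosition u s l r z ≡ r
    byPosition-right R0≤u u<Z rewrite <ᵇ-false (≤⇒≯ (≤-trans (m≤m+n L0 ℓ) R0≤u)) | <ᵇ-false (≤⇒≯ R0≤u) | <ᵇ-true u<Z =
      refl

    byPosition-spike : byPosition Z s l r z ≡ z
    byPosition-spike rewrite <ᵇ-false (≤⇒≯ (≤-trans (m≤m+n L0 ℓ) (m≤m+n R0 ℓ))) | <ᵇ-false (≤⇒≯ (m≤m+n R0 ℓ))
                           | <ᵇ-false (<-irrefl {Z} refl) = refl

  -- Reverses the spine and swaps the two bunches of end leaves; z stays put.
  mirror : ℕ → ℕ
  mirror u = byPosition u (D ∸ u) (u + ℓ) (u ∸ ℓ) u

  mirror-spine : ∀ {u} → u ≤ D → mirror u ≡ D ∸ u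
  mirror-spine = byPosition-spine

  mirror-left : ∀ {u} → L0 ≤ u → u < R0 → mirror u ≡ u + ℓ
  mirror-left = byPosition-left

  mirror-right : ∀ {u} → R0 ≤ u → u < Z → mirror u ≡ u ∸ ℓ
  mirror-right = byPosition-right

  mirror-spike : mirror Z ≡ Z
  mirror-spike = byPosition-spike

  left→right : ∀ {u} → L0 ≤ u → u < R0 → R0 ≤ u + ℓ × u + ℓ < Z
  left→right L0≤u u<R0 = +-monoˡ-≤ ℓ L0≤u , +-monoˡ-< ℓ u<R0

  right→left : ∀ {u} → R0 ≤ u → u < Z → L0 ≤ u ∸ ℓ × u ∸ ℓ < R0
  right→left {u} R0≤u u<Z =
    subst (_≤ u ∸ ℓ) (m+n∸n≡m L0 ℓ) (∸-monoˡ-≤ ℓ R0≤u) ,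
    +-cancelʳ-< ℓ (u ∸ ℓ) R0 (subst (_< Z) (sym (m∸n+n≡m (≤-trans (m≤n+m ℓ L0) R0≤u))) u<Z)

  mirror<N : ∀ {u} → u < N → mirror u < N
  mirror<N {u} u<N with position u<N
  ... | spine u≤D      rewrite mirror-spine u≤D      = spine<N (m∸n≤m D u)
  ... | left L0≤u u<R0 rewrite mirror-left L0≤u u<R0 = <-trans (proj₂ (left→right L0≤u u<R0)) Z<N
  ... | right R0≤u u<Z rewrite mirror-right R0≤u u<Z = <-trans (<-≤-trans (proj₂ (right→left R0≤u u<Z)) (m≤m+n R0 ℓ)) Z<N
  ... | spike refl     rewrite mirror-spike          = Z<N

  mirror-involutive : ∀ {u} → u < N → mirror (mirror u) ≡ u
  mirror-involutive {u} u<N with position u<N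
  ... | spine u≤D rewrite mirror-spine u≤D | mirror-spine (m∸n≤m D u) = m∸[m∸n]≡n u≤D
  ... | left L0≤u u<R0
    rewrite mirror-left L0≤u u<R0 | mirror-right (proj₁ (left→right L0≤u u<R0)) (proj₂ (left→right L0≤u u<R0)) =
    m+n∸n≡m u ℓ
  ... | right R0≤u u<Z
    rewrite mirror-right R0≤u u<Z | mirror-left (proj₁ (right→left R0≤u u<Z)) (proj₂ (right→left R0≤u u<Z)) =
    m∸n+n≡m (≤-trans (m≤n+m ℓ L0) R0≤u)
  ... | spike refl rewrite mirror-spike | mirror-spike = refl

module Broom (D ℓ p : ℕ) (p<D : p < D) where
  open Layout D ℓ public
  open Spine D
  open Weights D ℓ

  -- nbBase a b says that b is the parent of a in the tree rooted at v_{d-1}.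
  toParent : ℕ → ℕ → Bool
  toParent = nbBase (suc (suc D)) ℓ (suc p)

  adjℕ : ℕ → ℕ → Bool
  adjℕ a b = toParent a b ∨ toParent b a

  open NatGraph N adjℕ public

  anchor : ℕ → ℕ
  anchor u = byPosition u u 0 D p

  anchor-spine : ∀ {u} → u ≤ D → anchor u ≡ u
  anchor-spine = byPosition-spine

  anchor-left : ∀ {u} → L0 ≤ u → u < R0 → anchor u ≡ 0
  anchor-left = byPosition-left

  anchor-right : ∀ {u} → R0 ≤ u → u < Z → anchor u ≡ D
  anchor-right = byPosition-right

  anchor-spike : anchor Z ≡ p
  anchor-spike = byPosition-spike

  anchor≤D : ∀ u → anchor u ≤ D
  anchor≤D u with u <ᵇ L0 | proof (u <? L0)
  ... | true  | ofʸ u<L0 = ≤-pred u<L0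
  ... | false | _ with u <ᵇ R0
  ...   | true  = z≤n
  ...   | false with u <ᵇ Z
  ...     | true  = ≤-refl
  ...     | false = <⇒≤ p<D

  toParent-spine : ∀ {a} b → a ≤ D → toParent a b ≡ (b ≡ᵇ suc a) ∧ (b <ᵇ L0)
  toParent-spine {a} b a≤D
    rewrite <ᵇ-true (s≤s a≤D) | <ᵇ-true (<-≤-trans (s≤s a≤D) (m≤m+n L0 ℓ))
          | ≡ᵇ-false {a} {Z} (λ a≡Z → <⇒≱ (s≤s a≤D) (≤-trans (≤-trans (m≤m+n L0 ℓ) (m≤m+n R0 ℓ)) (≤-reflexive (sym a≡Z))))
    = ∨-identityʳ _

  no-spine-parent : ∀ {a} b → D ≤ a → ((b ≡ᵇ suc a) ∧ (b <ᵇ L0)) ≡ false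
  no-spine-parent {a} b D≤a with b ≡ᵇ suc a | proof (b ≟ suc a)
  ... | true  | ofʸ refl = <ᵇ-false (<⇒≱ (s≤s D≤a) ∘ ≤-pred)
  ... | false | _        = refl

  toParent-leaf : ∀ {a} b → L0 ≤ a → a < N → toParent a b ≡ (b ≡ᵇ anchor a)
  toParent-leaf {a} b L0≤a a<N rewrite no-spine-parent b (≤-pred (m≤n⇒m≤1+n L0≤a)) | <ᵇ-false (<⇒≱ (s≤s L0≤a) ∘ ≤-pred)
    with a <ᵇ R0 | proof (a <? R0)
  ... | true  | ofʸ a<R0 rewrite ≡ᵇ-false {a} {Z} (λ a≡Z → <⇒≱ a<R0 (≤-trans (m≤m+n R0 ℓ) (≤-reflexive (sym a≡Z)))) =
    ∨-identityʳ _
  ... | false | ofⁿ _ with a <ᵇ Z | proof (a <? Z)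
  ...   | true  | ofʸ a<Z rewrite ≡ᵇ-false {a} {Z} (<⇒≢ a<Z) = ∨-identityʳ _
  ...   | false | ofⁿ a≮Z rewrite ≡ᵇ-true (≤-antisym (≤-pred (≤-trans a<N (≤-reflexive N≡1+Z))) (≮⇒≥ a≮Z)) = refl

  toParent-spine⇒ : ∀ {a b} → a ≤ D → T (toParent a b) → b ≡ suc a × b ≤ D
  toParent-spine⇒ {a} {b} a≤D par-ab with Equivalence.to T-∧ (subst T (toParent-spine b a≤D) par-ab)
  ... | b≡1+a , b<L0 = ≡ᵇ⇒≡ b (suc a) b≡1+a , ≤-pred (<ᵇ⇒< b L0 b<L0)

  parent≤D : ∀ {a b} → a < N → T (toParent a b) → b ≤ D
  parent≤D {a} {b} a<N par-ab with a ≤? D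
  ... | yes a≤D = proj₂ (toParent-spine⇒ a≤D par-ab)
  ... | no  a≰D = subst (_≤ D) (sym (≡ᵇ⇒≡ b (anchor a) (subst T (toParent-leaf b (≰⇒> a≰D) a<N) par-ab))) (anchor≤D a)

  toParent-asym : ∀ {a b} → a < N → b < N → T (toParent a b) → T (toParent b a) → ⊥
  toParent-asym {a} {b} a<N b<N par-ab par-ba
    with toParent-spine⇒ {a} {b} (parent≤D {b} {a} b<N par-ba) par-ab
       | toParent-spine⇒ {b} {a} (parent≤D {a} {b} a<N par-ab) par-ba
  ... | b≡1+a , _ | a≡1+b , _ = <-asym (≤-reflexive (sym b≡1+a)) (≤-reflexive (sym a≡1+b))

  pendants : ℕ → (ℕ → ℕ) → ℕ
  pendants u g = ∑ leafCount (λ x → if u ≡ᵇ anchor (L0 + x) then g (L0 + x) else 0)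

  nbrΣ-split : ∀ {u} g → u < N →
               nbrΣ u g ≡ ∑ N (λ w → if toParent u w then g w else 0) + ∑ N (λ w → if toParent w u then g w else 0)
  nbrΣ-split {u} g u<N =
    trans (∑-cong N λ w w<N → if-∨ (toParent u w) (toParent w u) (g w) (toParent-asym u<N w<N)) (∑-+ N _ _)

  nbrΣ-spine : ∀ {i} g → i ≤ D → nbrΣ i g ≡ pathNbrs i g + pendants i g
  nbrΣ-spine {i} g i≤D = begin
    nbrΣ i g
      ≡⟨ nbrΣ-split g (spine<N i≤D) ⟩
    ∑ N (λ w → if toParent i w then g w else 0) + ∑ N (λ w → if toParent w i then g w else 0)
      ≡⟨ cong₂ _+_ (trans (∑-cong N λ w _ → to-parent w) (∑-pick N _ (1+spine<N i≤D)))
                   (trans (vertices-split _) (cong₂ _+_ from-child from-pendant)) ⟩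
    (if i <ᵇ D then g (suc i) else 0) + ((if 0 <ᵇ i then g (pred i) else 0) + pendants i g)
      ≡⟨ +-assoc (if i <ᵇ D then g (suc i) else 0) (if 0 <ᵇ i then g (pred i) else 0) (pendants i g) ⟨
    pathNbrs i g + pendants i g
      ∎
    where
    open ≡-Reasoning
    to-parent : ∀ w → (if toParent i w then g w else 0) ≡ (if w ≡ᵇ suc i then (if i <ᵇ D then g (suc i) else 0) else 0)
    to-parent w rewrite toParent-spine w i≤D with w ≡ᵇ suc i | proof (w ≟ suc i)
    ... | true  | ofʸ refl = refl
    ... | false | _        = refl
    child : ∀ i → i ≤ D → ∑ (suc D) (λ w → if i ≡ᵇ suc w then g w else 0) ≡ (if 0 <ᵇ i then g (pred i) else 0)
    child zero    _   = ∑-zero (suc D) λ _ _ → refl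
    child (suc j) j<D =
      trans (∑-cong (suc D) λ w _ → cong (if_then g w else 0) (≡ᵇ-sym j w)) (∑-pick (suc D) g (s≤s (<⇒≤ j<D)))
    from-child : ∑ (suc D) (λ w → if toParent w i then g w else 0) ≡ (if 0 <ᵇ i then g (pred i) else 0)
    from-child = trans (∑-cong (suc D) λ w w≤D → cong (if_then g w else 0) (trans (toParent-spine i (≤-pred w≤D))
                                                   (trans (cong ((i ≡ᵇ suc w) ∧_) (<ᵇ-true (s≤s i≤D))) (∧-identityʳ _))))
                       (child i i≤D)
    from-pendant : ∑ leafCount (λ x → if toParent (L0 + x) i then g (L0 + x) else 0) ≡ pendants i g
    from-pendant = ∑-cong leafCount λ x x<leafCount →
      cong (if_then g (L0 + x) else 0) (toParent-leaf i (m≤m+n L0 x) (L0+x<N x<leafCount))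

  nbrΣ-leaf : ∀ {u} g → L0 ≤ u → u < N → nbrΣ u g ≡ g (anchor u)
  nbrΣ-leaf {u} g L0≤u u<N = begin
    nbrΣ u g
      ≡⟨ nbrΣ-split g u<N ⟩
    ∑ N (λ w → if toParent u w then g w else 0) + ∑ N (λ w → if toParent w u then g w else 0)
      ≡⟨ cong₂ _+_ to-anchor no-children ⟩
    g (anchor u) + 0
      ≡⟨ +-identityʳ _ ⟩
    g (anchor u)
      ∎
    where
    open ≡-Reasoning
    to-anchor : ∑ N (λ w → if toParent u w then g w else 0) ≡ g (anchor u)
    to-anchor = trans (∑-cong N λ w _ → cong (if_then g w else 0) (toParent-leaf w L0≤u u<N)) (∑-pick N g (spine<N (anchor≤D u)))
    childless : ∀ w → w < N → (if toParent w u then g w else 0) ≡ 0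
    childless w w<N with toParent w u in par-wu
    ... | true  = contradiction (parent≤D {w} {u} w<N (subst T (sym par-wu) tt)) (<⇒≱ L0≤u)
    ... | false = refl
    no-children : ∑ N (λ w → if toParent w u then g w else 0) ≡ 0
    no-children = ∑-zero N childless

  pendants-count : ∀ i → pendants i (λ _ → 1) ≡ pendantCount p i
  pendants-count i = trans (leaves-split (λ u → if i ≡ᵇ anchor u then 1 else 0))
    (cong₂ _+_ (cong₂ _+_ (count anchor-left (m≤m+n L0) (+-monoʳ-< L0)) (count anchor-right (m≤m+n R0) (+-monoʳ-< R0)))
               (cong (λ a → if i ≡ᵇ a then 1 else 0) anchor-spike))
    where
    count : ∀ {a} {lo hi first : ℕ} → (∀ {u} → lo ≤ u → u < hi → anchor u ≡ a) →
            (∀ x → lo ≤ first + x) → (∀ {x} → x < ℓ → first + x < hi) →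
            ∑ ℓ (λ x → if i ≡ᵇ anchor (first + x) then 1 else 0) ≡ (if i ≡ᵇ a then ℓ else 0)
    count {a} anchor≡ lo≤ <hi =
      trans (∑-cong ℓ λ x x<ℓ → cong (λ b → if i ≡ᵇ b then 1 else 0) (anchor≡ (lo≤ x) (<hi x<ℓ))) (∑-const-indicator ℓ (i ≡ᵇ a))

  degree-spine : ∀ {i} → i ≤ D → degree i ≡ pathDeg i + pendantCount p i
  degree-spine {i} i≤D = trans (nbrΣ-spine (λ _ → 1) i≤D) (cong (pathDeg i +_) (pendants-count i))

  degree-leaf : ∀ {u} → L0 ≤ u → u < N → degree u ≡ 1
  degree-leaf = nbrΣ-leaf (λ _ → 1)

  weight-degree : ∀ {i} → i ≤ D → weight p i ≡ degree i + pendants i (λ _ → 1)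
  weight-degree {i} i≤D = sym (cong₂ _+_ (degree-spine i≤D) (pendants-count i))

  ∑-pendants : ∀ g → ∑ (suc D) (λ i → pendants i (λ _ → 1) * g i) ≡ ∑ leafCount (λ x → g (anchor (L0 + x)))
  ∑-pendants g = begin
    ∑ (suc D) (λ i → pendants i (λ _ → 1) * g i)
      ≡⟨ ∑-cong (suc D) (λ i _ → trans (∑-*ʳ leafCount _ (g i))
                                       (∑-cong leafCount λ x _ → if-*ˡ (i ≡ᵇ anchor (L0 + x)) (g i))) ⟩
    ∑ (suc D) (λ i → ∑ leafCount (λ x → if i ≡ᵇ anchor (L0 + x) then g i else 0))
      ≡⟨ ∑-comm (suc D) leafCount _ ⟩
    ∑ leafCount (λ x → ∑ (suc D) (λ i → if i ≡ᵇ anchor (L0 + x) then g i else 0))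
      ≡⟨ ∑-cong leafCount (λ x _ → ∑-pick (suc D) g (s≤s (anchor≤D (L0 + x)))) ⟩
    ∑ leafCount (λ x → g (anchor (L0 + x)))
      ∎
    where open ≡-Reasoning

  -- A leaf contributes its own value with degree 1, and its anchor's value through the anchor's weight.
  degree-sum : ∀ g → ∑ N (λ u → degree u * g u) + ∑ leafCount (λ x → g (anchor (L0 + x)))
                   ≡ ∑ (suc D) (λ i → weight p i * g i) + ∑ leafCount (λ x → g (L0 + x))
  degree-sum g = begin
    ∑ N (λ u → degree u * g u) + anchors   ≡⟨ cong (_+ anchors) (trans (vertices-split _) (cong (spine-part +_) leaf-part)) ⟩
    spine-part + leaves + anchors          ≡⟨ xy∙z≈xz∙y spine-part leaves anchors ⟩
    spine-part + anchors + leaves          ≡⟨ cong (_+ leaves) weights ⟨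
    ∑ (suc D) (λ i → weight p i * g i) + leaves ∎
    where
    open ≡-Reasoning
    spine-part leaves anchors : ℕ
    spine-part = ∑ (suc D) (λ i → degree i * g i)
    leaves = ∑ leafCount (λ x → g (L0 + x))
    anchors = ∑ leafCount (λ x → g (anchor (L0 + x)))
    leaf-part : ∑ leafCount (λ x → degree (L0 + x) * g (L0 + x)) ≡ leaves
    leaf-part = ∑-cong leafCount λ x x<lc → trans (cong (_* g (L0 + x)) (degree-leaf (m≤m+n L0 x) (L0+x<N x<lc))) (+-identityʳ _)
    weights : ∑ (suc D) (λ i → weight p i * g i) ≡ spine-part + anchors
    weights = trans (∑-cong (suc D) λ i i≤D → trans (cong (_* g i) (weight-degree (≤-pred i≤D)))
                                                    (*-distribʳ-+ (g i) (degree i) _))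
                    (trans (∑-+ (suc D) _ _) (cong (spine-part +_) (∑-pendants g)))

  total-degree : ∑ N degree ≡ suc Q
  total-degree = begin
    ∑ N degree                       ≡⟨ ∑-cong N (λ u _ → sym (*-identityʳ (degree u))) ⟩
    ∑ N (λ u → degree u * 1)         ≡⟨ +-cancelʳ-≡ _ _ _ (degree-sum (λ _ → 1)) ⟩
    ∑ (suc D) (λ i → weight p i * 1) ≡⟨ ∑-cong (suc D) (λ i _ → *-identityʳ (weight p i)) ⟩
    ∑ (suc D) (weight p)             ≡⟨ total-weight (<⇒≤ p<D) ⟩
    suc Q                            ∎
    where open ≡-Reasoning

  module Target {h t} (t<N : t < N) (eqs : IsHittingColumn h t) where

    q : ℕ
    q = anchor t

    J : ℕ
    J = ∑ N (λ u → degree u * h u)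

    leaf-value : ∀ {u} → L0 ≤ u → u < N → u ≢ t → h u ≡ suc (h (anchor u))
    leaf-value {u} L0≤u u<N u≢t = begin
      h u                 ≡⟨ *-identityˡ (h u) ⟨
      1 * h u             ≡⟨ cong (_* h u) (degree-leaf L0≤u u<N) ⟨
      degree u * h u      ≡⟨ proj₂ eqs u u<N u≢t ⟩
      degree u + nbrΣ u h ≡⟨ cong₂ _+_ (degree-leaf L0≤u u<N) (nbrΣ-leaf h L0≤u u<N) ⟩
      suc (h (anchor u))  ∎
      where open ≡-Reasoning

    pendants-value : ∀ {i} → i ≢ q → pendants i h ≡ pendants i (λ _ → 1) * suc (h i)
    pendants-value {i} i≢q = trans (∑-cong leafCount pendant) (sym (∑-*ʳ leafCount _ _))
      where
      pendant : ∀ x → x < leafCount → (if i ≡ᵇ anchor (L0 + x) then h (L0 + x) else 0)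
                                    ≡ (if i ≡ᵇ anchor (L0 + x) then 1 else 0) * suc (h i)
      pendant x x<lc with i ≡ᵇ anchor (L0 + x) | proof (i ≟ anchor (L0 + x))
      ... | true  | ofʸ i≡a = trans (leaf-value (m≤m+n L0 x) (L0+x<N x<lc) λ L0+x≡t → i≢q (trans i≡a (cong anchor L0+x≡t)))
                                    (trans (cong (suc ∘ h) (sym i≡a)) (sym (*-identityˡ _)))
      ... | false | _       = refl

    spine-balanced : ∀ {i} → i ≤ D → i ≢ q → Balanced (weight p) h i
    spine-balanced {i} i≤D i≢q = absorb (pathDeg i) (pendantCount p i) (h i) (pathNbrs i h) (begin
      (pathDeg i + pendantCount p i) * h i
        ≡⟨ cong (_* h i) (degree-spine i≤D) ⟨
      degree i * h i
        ≡⟨ proj₂ eqs i (spine<N i≤D) (λ i≡t → i≢q (trans (sym (anchor-spine i≤D)) (cong anchor i≡t))) ⟩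
      degree i + nbrΣ i h
        ≡⟨ cong₂ _+_ (degree-spine i≤D) (trans (nbrΣ-spine h i≤D) (cong (pathNbrs i h +_)
                       (trans (pendants-value i≢q) (cong (_* suc (h i)) (pendants-count i))))) ⟩
      (pathDeg i + pendantCount p i) + (pathNbrs i h + pendantCount p i * suc (h i))
        ∎)
      where
      open ≡-Reasoning
      absorb : ∀ δ c x P → (δ + c) * x ≡ (δ + c) + (P + c * suc x) → δ * x ≡ δ + c + c + P
      absorb δ c x P eq = +-cancelʳ-≡ (c * x) _ _ (trans (expand δ c x) (trans eq (regroup δ c x P)))
        where
        expand : ∀ δ c x → δ * x + c * x ≡ (δ + c) * x
        expand = solve-∀
        regroup : ∀ δ c x P → (δ + c) + (P + c * suc x) ≡ δ + c + c + P + c * x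
        regroup = solve-∀

    weighted-sum : ∑ (suc D) (λ i → weight p i * h i) ≡ ∑ (suc D) (weight p) * h q + spineCost p q
    weighted-sum = ∑-by-parts-around D q (anchor≤D t) reflected left-eqs right-eqs
      where
      p≤D = <⇒≤ p<D
      reflected : ∀ i → i < D ∸ q → weight (D ∸ p) i ≡ weight p (D ∸ i)
      reflected i i<D∸q = sym (weight-reflect p≤D (≤-trans (<⇒≤ i<D∸q) (m∸n≤m D q)))
      left-eqs : ∀ i → i < q → PathEq (weight p) h i
      left-eqs i i<q = balanced⇒PathEq i i<D (spine-balanced (<⇒≤ i<D) (<⇒≢ i<q))
        where
        i<D = <-≤-trans i<q (anchor≤D t)
      right-eqs : ∀ i → i < D ∸ q → PathEq (weight (D ∸ p)) (h ∘ (D ∸_)) i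
      right-eqs i i<D∸q = balanced⇒PathEq i i<D
        (subst (λ w → pathDeg i * h (D ∸ i) ≡ w + pathNbrs i (h ∘ (D ∸_))) (weight-reflect p≤D (<⇒≤ i<D))
               (balanced-reflect {weight p} {h} (<⇒≤ i<D) (spine-balanced (m∸n≤m D i) D∸i≢q)))
        where
        i<D : i < D
        i<D = <-≤-trans i<D∸q (m∸n≤m D q)
        D∸i≢q : D ∸ i ≢ q
        D∸i≢q D∸i≡q = <-irrefl (trans (sym (m∸[m∸n]≡n (<⇒≤ i<D))) (cong (D ∸_) D∸i≡q)) i<D∸q

    anchorSum leafSum : ℕ
    anchorSum = ∑ leafCount (λ x → h (anchor (L0 + x)))
    leafSum = ∑ leafCount (λ x → h (L0 + x))

    anchorSum+leafCount : ∑ leafCount (λ x → suc (h (anchor (L0 + x)))) ≡ anchorSum + leafCount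
    anchorSum+leafCount = trans (∑-+ leafCount (λ _ → 1) _)
      (trans (cong (_+ anchorSum) (trans (∑-const leafCount 1) (*-identityʳ leafCount))) (+-comm leafCount anchorSum))

    leafSum-spine-target : t ≤ D → leafSum ≡ anchorSum + leafCount
    leafSum-spine-target t≤D = trans (∑-cong leafCount λ x x<lc → leaf-value (m≤m+n L0 x) (L0+x<N x<lc) (not-target x))
                                     anchorSum+leafCount
      where
      not-target : ∀ x → L0 + x ≢ t
      not-target x L0+x≡t = <⇒≱ (s≤s t≤D) (≤-trans (m≤m+n L0 x) (≤-reflexive L0+x≡t))

    leafSum-leaf-target : L0 ≤ t → leafSum + suc (h q) ≡ anchorSum + leafCount
    leafSum-leaf-target L0≤t = begin
      leafSum + suc (h q)
        ≡⟨ cong (λ u → leafSum + suc (h (anchor u))) (sym L0+x₀≡t) ⟩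
      leafSum + suc (h (anchor (L0 + x₀)))
        ≡⟨ ∑-update leafCount x₀<lc others ⟩
      ∑ leafCount (λ x → suc (h (anchor (L0 + x)))) + h (L0 + x₀)
        ≡⟨ cong₂ _+_ anchorSum+leafCount (trans (cong h L0+x₀≡t) (proj₁ eqs)) ⟩
      anchorSum + leafCount + 0
        ≡⟨ +-identityʳ _ ⟩
      anchorSum + leafCount
        ∎
      where
      open ≡-Reasoning
      x₀ = t ∸ L0
      L0+x₀≡t : L0 + x₀ ≡ t
      L0+x₀≡t = m+[n∸m]≡n L0≤t
      x₀<lc : x₀ < leafCount
      x₀<lc = +-cancelˡ-< L0 x₀ leafCount
                (≤-trans (≤-reflexive (cong suc L0+x₀≡t)) (≤-trans t<N (≤-reflexive (sym (+-suc L0 (ℓ + ℓ))))))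
      others : ∀ x → x < leafCount → x ≢ x₀ → h (L0 + x) ≡ suc (h (anchor (L0 + x)))
      others x x<lc x≢x₀ = leaf-value (m≤m+n L0 x) (L0+x<N x<lc)
                                      λ L0+x≡t → x≢x₀ (+-cancelˡ-≡ L0 x x₀ (trans L0+x≡t (sym L0+x₀≡t)))

    hitting-anchor : L0 ≤ t → h q ≡ Q
    hitting-anchor L0≤t = suc-injective (begin
      suc (h q)           ≡⟨ cong₂ _+_ (degree-leaf L0≤t t<N) (nbrΣ-leaf h L0≤t t<N) ⟨
      degree t + nbrΣ t h ≡⟨ kac (λ u w → ∨-comm (toParent u w) (toParent w u)) t<N eqs ⟩
      ∑ N degree          ≡⟨ total-degree ⟩
      suc Q               ∎)
      where open ≡-Reasoning

    joining-core : J + anchorSum ≡ suc Q * h q + spineCost p q + leafSum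
    joining-core = trans (degree-sum h)
      (cong (_+ leafSum) (trans weighted-sum (cong (λ W → W * h q + spineCost p q) (total-weight (<⇒≤ p<D)))))

    joining-spine : t ≤ D → J ≡ leafCount + spineCost p t
    joining-spine t≤D = +-cancelʳ-≡ anchorSum _ _ (begin
      J + anchorSum
        ≡⟨ joining-core ⟩
      suc Q * h q + spineCost p q + leafSum
        ≡⟨ cong₂ (λ x y → suc Q * x + spineCost p y + leafSum) h[q]≡0 (anchor-spine t≤D) ⟩
      suc Q * 0 + spineCost p t + leafSum
        ≡⟨ cong₂ (λ z y → z + spineCost p t + y) (*-zeroʳ (suc Q)) (leafSum-spine-target t≤D) ⟩
      spineCost p t + (anchorSum + leafCount)
        ≡⟨ regroup (spineCost p t) anchorSum leafCount ⟩
      leafCount + spineCost p t + anchorSum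
        ∎)
      where
      open ≡-Reasoning
      h[q]≡0 : h q ≡ 0
      h[q]≡0 = trans (cong h (anchor-spine t≤D)) (proj₁ eqs)
      regroup : ∀ S A l → S + (A + l) ≡ l + S + A
      regroup = solve-∀

    joining-leaf : L0 ≤ t → J + 1 ≡ Q * Q + (leafCount + spineCost p q)
    joining-leaf L0≤t = +-cancelʳ-≡ (anchorSum + Q) _ _ (begin
      J + 1 + (anchorSum + Q)
        ≡⟨ shift J anchorSum Q ⟩
      J + anchorSum + suc Q
        ≡⟨ cong (_+ suc Q) joining-core ⟩
      suc Q * h q + spineCost p q + leafSum + suc Q
        ≡⟨ +-assoc (suc Q * h q + spineCost p q) leafSum (suc Q) ⟩
      suc Q * h q + spineCost p q + (leafSum + suc Q)
        ≡⟨ cong (λ x → suc Q * h q + spineCost p q + (leafSum + suc x)) (hitting-anchor L0≤t) ⟨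
      suc Q * h q + spineCost p q + (leafSum + suc (h q))
        ≡⟨ cong₂ (λ x y → suc Q * x + spineCost p q + y) (hitting-anchor L0≤t) (leafSum-leaf-target L0≤t) ⟩
      suc Q * Q + spineCost p q + (anchorSum + leafCount)
        ≡⟨ regroup Q (spineCost p q) anchorSum leafCount ⟩
      Q * Q + (leafCount + spineCost p q) + (anchorSum + Q)
        ∎)
      where
      open ≡-Reasoning
      shift : ∀ J A Q → J + 1 + (A + Q) ≡ J + A + suc Q
      shift = solve-∀
      regroup : ∀ Q S A l → suc Q * Q + S + (A + l) ≡ Q * Q + (l + S) + (A + Q)
      regroup = solve-∀

  spineJoining : ℕ → ℕ
  spineJoining j = leafCount + spineCost p j

  spineJoining-valley : ∀ j → j ≤ D → spineJoining j ≤ spineJoining 0 ⊔ spineJoining D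
  spineJoining-valley j j≤D =
    ≤-trans (+-monoʳ-≤ leafCount (spineCost-valley p j j≤D)) (≤-reflexive (+-distribˡ-⊔ leafCount _ _))

  module _ {H} (hit : IsHittingTime graph H) where

    joining-bound : ∀ v → joining graph H v + 1 ≤ Q * Q + (spineJoining 0 ⊔ spineJoining D)
    joining-bound v with toℕ v ≤? D
    ... | yes t≤D = begin
      joining graph H v + 1                     ≡⟨ cong (_+ 1) (trans (joining≡∑ H v) (joining-spine t≤D)) ⟩
      spineJoining (toℕ v) + 1                  ≤⟨ +-mono-≤ (spineJoining-valley (toℕ v) t≤D) (s≤s z≤n) ⟩
      (spineJoining 0 ⊔ spineJoining D) + Q * Q ≡⟨ +-comm _ (Q * Q) ⟩
      Q * Q + (spineJoining 0 ⊔ spineJoining D) ∎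
      where
      open ≤-Reasoning
      open Target (toℕ<n v) (hittingColumn hit v)
    ... | no  t≰D = begin
      joining graph H v + 1                     ≡⟨ cong (_+ 1) (joining≡∑ H v) ⟩
      J + 1                                     ≡⟨ joining-leaf (≰⇒> t≰D) ⟩
      Q * Q + spineJoining q                    ≤⟨ +-monoʳ-≤ (Q * Q) (spineJoining-valley q (anchor≤D (toℕ v))) ⟩
      Q * Q + (spineJoining 0 ⊔ spineJoining D) ∎
      where
      open ≤-Reasoning
      open Target (toℕ<n v) (hittingColumn hit v)

    joining-at-leaf : ∀ {u} (u<N : u < N) → L0 ≤ u → joining graph H (fromℕ< u<N) + 1 ≡ Q * Q + spineJoining (anchor u)
    joining-at-leaf {u} u<N L0≤u = begin
      joining graph H v + 1             ≡⟨ cong (_+ 1) (joining≡∑ H v) ⟩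
      J + 1                             ≡⟨ joining-leaf (≤-trans L0≤u (≤-reflexive (sym (toℕ-fromℕ< u<N)))) ⟩
      Q * Q + spineJoining (anchor (toℕ v)) ≡⟨ cong (λ t → Q * Q + spineJoining (anchor t)) (toℕ-fromℕ< u<N) ⟩
      Q * Q + spineJoining (anchor u)   ∎
      where
      open ≡-Reasoning
      v = fromℕ< u<N
      open Target (toℕ<n v) (hittingColumn hit v)

    maxJoining-formula : 0 < ℓ → maxJoining graph H + 1 ≡ Q * Q + (leafCount + (endCost (D ∸ p) ⊔ endCost p))
    maxJoining-formula 0<ℓ = trans (≤-antisym upper lower) (cong (Q * Q +_)
      (trans (cong (spineJoining 0 ⊔_) (cong (leafCount +_) (spineCost-D p))) (sym (+-distribˡ-⊔ leafCount _ _))))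
      where
      M : ℕ
      M = maxJoining graph H
      upper : M + 1 ≤ Q * Q + (spineJoining 0 ⊔ spineJoining D)
      upper = ≤-trans (≤-reflexive (+-comm M 1))
        (s≤s (maxFin-lub (joining graph H) _ λ v → ≤-pred (≤-trans (≤-reflexive (+-comm 1 _)) (joining-bound v))))
      at-leaf : ∀ {u} (u<N : u < N) → L0 ≤ u → Q * Q + spineJoining (anchor u) ≤ M + 1
      at-leaf u<N L0≤u =
        ≤-trans (≤-reflexive (sym (joining-at-leaf u<N L0≤u))) (+-monoˡ-≤ 1 (≤-maxFin (joining graph H) (fromℕ< u<N)))
      lower : Q * Q + (spineJoining 0 ⊔ spineJoining D) ≤ M + 1
      lower = ≤-trans (≤-reflexive (+-distribˡ-⊔ (Q * Q) _ _)) (⊔-lub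
        (subst (λ a → Q * Q + spineJoining a ≤ M + 1) (anchor-left ≤-refl (m<m+n L0 0<ℓ)) (at-leaf (1+spine<N ≤-refl) ≤-refl))
        (subst (λ a → Q * Q + spineJoining a ≤ M + 1) (anchor-right ≤-refl (m<m+n R0 0<ℓ))
               (at-leaf (L0+x<N {ℓ} (s≤s (m≤m+n ℓ ℓ))) (m≤m+n L0 ℓ))))

-- Mirror symmetry

module Reflection (D ℓ p : ℕ) (0<p : 0 < p) (p<D : p < D) where
  open Broom D ℓ p p<D

  D∸p<D : D ∸ p < D
  D∸p<D = ∸-monoʳ-< 0<p (<⇒≤ p<D)

  module B′ = Broom D ℓ (D ∸ p) D∸p<D

  mirror-anchor : ∀ {u} → L0 ≤ u → u < N → L0 ≤ mirror u × B′.anchor (mirror u) ≡ D ∸ anchor u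
  mirror-anchor L0≤u u<N with position u<N
  ... | spine u≤D = contradiction L0≤u (<⇒≱ (s≤s u≤D))
  ... | left L0≤u′ u<R0 with left→right L0≤u′ u<R0
  ...   | R0≤u+ℓ , u+ℓ<Z rewrite mirror-left L0≤u′ u<R0 | anchor-left L0≤u′ u<R0 =
    ≤-trans (m≤m+n L0 ℓ) R0≤u+ℓ , B′.anchor-right R0≤u+ℓ u+ℓ<Z
  mirror-anchor L0≤u u<N | right R0≤u u<Z with right→left R0≤u u<Z
  ...   | L0≤u∸ℓ , u∸ℓ<R0 rewrite mirror-right R0≤u u<Z | anchor-right R0≤u u<Z =
    L0≤u∸ℓ , trans (B′.anchor-left L0≤u∸ℓ u∸ℓ<R0) (sym (n∸n≡0 D))
  mirror-anchor L0≤u u<N | spike refl rewrite mirror-spike | anchor-spike = ≤-trans (m≤m+n L0 ℓ) (m≤m+n R0 ℓ) , B′.anchor-spike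

  mirror-parent : ∀ {a b} → a < N → T (toParent a b) → T (B′.adjℕ (mirror a) (mirror b))
  mirror-parent {a} {b} a<N par-ab with a ≤? D
  ... | yes a≤D with toParent-spine⇒ {a} {b} a≤D par-ab
  ...   | refl , a<D rewrite mirror-spine a≤D | mirror-spine a<D =
    Equivalence.from (T-∨ {B′.toParent (D ∸ a) (D ∸ suc a)})
      (inj₂ (subst T (sym (B′.toParent-spine (D ∸ a) (m∸n≤m D (suc a))))
                     (Equivalence.from T-∧ (≡⇒≡ᵇ _ _ (+-∸-assoc 1 a<D) , <⇒<ᵇ (s≤s (m∸n≤m D a))))))
  mirror-parent {a} {b} a<N par-ab | no a≰D =
    Equivalence.from (T-∨ {y = B′.toParent (mirror b) (mirror a)})
      (inj₁ (subst T (sym (B′.toParent-leaf (mirror b) (proj₁ leaf) (mirror<N a<N))) (≡⇒≡ᵇ _ _ mirror-b)))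
    where
    leaf = mirror-anchor (≰⇒> a≰D) a<N
    mirror-b : mirror b ≡ B′.anchor (mirror a)
    mirror-b = trans (cong mirror (≡ᵇ⇒≡ b (anchor a) (subst T (toParent-leaf b (≰⇒> a≰D) a<N) par-ab)))
                     (trans (mirror-spine (anchor≤D a)) (sym (proj₂ leaf)))

  mirror-adj : ∀ {a b} → a < N → b < N → T (adjℕ a b) → T (B′.adjℕ (mirror a) (mirror b))
  mirror-adj {a} {b} a<N b<N adj-ab with Equivalence.to T-∨ adj-ab
  ... | inj₁ par-ab = mirror-parent {a} {b} a<N par-ab
  ... | inj₂ par-ba = subst T (∨-comm (B′.toParent (mirror b) (mirror a)) (B′.toParent (mirror a) (mirror b)))
                              (mirror-parent {b} {a} b<N par-ba)

reflection-iso : ∀ D ℓ p → 0 < p → p < D →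
                 nearDoubleBroom (2 + D) ℓ (suc p) ≅ nearDoubleBroom (2 + D) ℓ (suc (D ∸ p))
reflection-iso D ℓ p 0<p p<D = ≅-by-involution adjℕ B′.adjℕ mirror mirror<N mirror-involutive
  λ {a} {b} a<N b<N → T-ext (mirror-adj {a} {b} a<N b<N) (back a<N b<N)
  where
  open Reflection D ℓ p 0<p p<D
  open Broom D ℓ p p<D
  module Back = Reflection D ℓ (D ∸ p) (m<n⇒0<n∸m p<D) D∸p<D
  back : ∀ {a b} → a < N → b < N → T (B′.adjℕ (mirror a) (mirror b)) → T (adjℕ a b)
  back {a} {b} a<N b<N adj′ =
    subst (λ r → T (nbBase (2 + D) ℓ (suc r) a b ∨ nbBase (2 + D) ℓ (suc r) b a)) (m∸[m∸n]≡n (<⇒≤ p<D))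
      (subst₂ (λ x y → T (Back.B′.adjℕ x y)) (mirror-involutive a<N) (mirror-involutive b<N)
        (Back.mirror-adj {mirror a} {mirror b} (mirror<N a<N) (mirror<N b<N) adj′))

-- The balanced broom

module Balancing (D ℓ : ℕ) (2≤D : 2 ≤ D) (0<ℓ : 0 < ℓ) where
  open Weights D ℓ
  open Layout D ℓ using (leafCount)

  c : ℕ
  c = D / 2

  open Midpoint endCost endCost-anti (proj₁ (half-midpoint D)) (proj₂ (half-midpoint D))

  c<D : c < D
  c<D = ≰⇒> λ D≤c → <⇒≱ (<-≤-trans z<s 2≤D)
                          (≤-trans D≤c (≤-trans (proj₁ (half-midpoint D)) (≤-reflexive (m≤n⇒m∸n≡0 D≤c))))

  broom : ℕ → Graph (2 + D + (ℓ + ℓ))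
  broom q = nearDoubleBroom (2 + D) ℓ (suc q)

  maxJoining+1 : ℕ → ℕ
  maxJoining+1 q = Q * Q + (leafCount + (endCost (D ∸ q) ⊔ endCost q))

  module _ {p H₀ H} (p<D : p < D) (hit₀ : IsHittingTime (broom c) H₀) (hit : IsHittingTime (broom p) H) where

    balanced-optimal : maxJoining (broom c) H₀ ≤ maxJoining (broom p) H
    balanced-optimal = +-cancelʳ-≤ 1 _ _ (begin
      maxJoining (broom c) H₀ + 1 ≡⟨ Broom.maxJoining-formula D ℓ c c<D hit₀ 0<ℓ ⟩
      maxJoining+1 c              ≤⟨ +-monoʳ-≤ (Q * Q) (+-monoʳ-≤ leafCount (midpoint-minimises p (<⇒≤ p<D))) ⟩
      maxJoining+1 p              ≡⟨ Broom.maxJoining-formula D ℓ p p<D hit 0<ℓ ⟨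
      maxJoining (broom p) H + 1  ∎)
      where open ≤-Reasoning

    balanced-unique : 0 < p → maxJoining (broom p) H ≡ maxJoining (broom c) H₀ → broom p ≅ broom c
    balanced-unique 0<p same with p ≟ c
    ... | yes refl = ↔-id _ , λ _ _ → refl
    ... | no  p≢c with p ≟ D ∸ c
    ...   | yes p≡D∸c =
      subst (λ r → broom p ≅ broom r) (trans (cong (D ∸_) p≡D∸c) (m∸[m∸n]≡n c≤D)) (reflection-iso D ℓ p 0<p p<D)
    ...   | no  p≢D∸c = contradiction (begin-strict
      maxJoining (broom c) H₀ + 1 ≡⟨ Broom.maxJoining-formula D ℓ c c<D hit₀ 0<ℓ ⟩
      maxJoining+1 c              <⟨ +-monoʳ-< (Q * Q) (+-monoʳ-< leafCount
                                                           (midpoint-unique endCost-strict p (<⇒≤ p<D) p≢c p≢D∸c)) ⟩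
      maxJoining+1 p              ≡⟨ Broom.maxJoining-formula D ℓ p p<D hit 0<ℓ ⟨
      maxJoining (broom p) H + 1  ≡⟨ cong (_+ 1) same ⟩
      maxJoining (broom c) H₀ + 1 ∎) (<-irrefl refl)
      where open ≤-Reasoning

lemma4p15 : (d ℓ k : ℕ) → 4 ≤ d → 1 ≤ ℓ → 2 ≤ k → k ≤ d ∸ 2 →
    (H₀ H : Fin (d + (ℓ + ℓ)) → Fin (d + (ℓ + ℓ)) → ℕ) →
    IsHittingTime (nearDoubleBroom d ℓ (d / 2)) H₀ →
    IsHittingTime (nearDoubleBroom d ℓ k) H →
    (maxJoining (nearDoubleBroom d ℓ (d / 2)) H₀ ≤ maxJoining (nearDoubleBroom d ℓ k) H)
    × (maxJoining (nearDoubleBroom d ℓ k) H ≡ maxJoining (nearDoubleBroom d ℓ (d / 2)) H₀ →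
       nearDoubleBroom d ℓ k ≅ nearDoubleBroom d ℓ (d / 2))
lemma4p15 (suc (suc D)) ℓ (suc p) (s≤s (s≤s 2≤D)) 0<ℓ (s≤s 0<p) p<D H₀ H hit₀ hit
  rewrite m/n≡1+[m∸n]/n {2 + D} {2} (s≤s (s≤s z≤n)) =
  balanced-optimal p<D hit₀ hit , balanced-unique p<D hit₀ hit 0<p
  where open Balancing D ℓ 2≤D 0<ℓ
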